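{- Define integers $T(n,k)$ for $n\ge 1$ and $k\in\mathbb{Z}$ by $T(1,1)=1$, $T(1,k)=0$ for $k\ne 1$, and $T(n,k)=k\,T(n-1,k)+(2n-k)\,T(n-1,k-1)$ for $n\ge 2$ (the second-order Eulerian triangle, OEIS A008517). Then for every $n\ge 1$ and every integer $j\ge 0$, the number of matchings on $[2n]$ with exactly $j$ left-nestings equals $T(n,n-j)$.
   Context: A matching on $[2n]$ is a partition of $\{1,\dots,2n\}$ into $n$ pairs $(a,b)$ with $a<b$. A left-nesting in a matching $X$ is a pair of pairs $(a,b),(c,d)\in X$ with $a<c<d<b$ and $c=a+1$. -}

module Defs where

open import Data.Nat as ℕ using (ℕ; zero; suc; _<_; _<?_)
open import Data.Nat.Properties as ℕₚ using ()
open import Data.Integer as ℤ using (ℤ; +_; _-_)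
open import Data.Fin using (Fin; toℕ)
open import Data.Vec using (Vec; lookup)
open import Data.List using (List; length; filter; cartesianProduct)
open import Data.List.Base using (allFin)
open import Data.List.Membership.Propositional using (_∈_)
open import Data.List.Relation.Unary.Unique.Propositional using (Unique)
open import Data.Product using (Σ; _×_; _,_; ∃)
open import Relation.Binary.PropositionalEquality using (_≡_; _≢_)
open import Relation.Nullary using (Dec; yes; no)
open import Relation.Nullary.Decidable using (_×-dec_)
open import Function.Bundles using (_⇔_)

-- Second-order Eulerian triangle T(n,k), n ≥ 1, k ∈ ℤ.
-- The value at n = 0 is a junk value (never used: the theorem assumes n ≥ 1).
T : ℕ → ℤ → ℤ
T zero k = + 0
T (suc zero) k with k ℤ.≟ + 1
... | yes _ = + 1
... | no  _ = + 0
T (suc (suc m)) k =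
  k ℤ.* T (suc m) k ℤ.+ ((+ (2 ℕ.* suc (suc m))) - k) ℤ.* T (suc m) (k - + 1)

-- A matching on [2n] (points 0,…,2n-1, i.e. 1,…,2n shifted by one), represented by
-- its partner map v : i ↦ the point paired with i.  A partition of the points
-- into pairs is the same as a fixed-point-free involution.
Matching : ℕ → Set
Matching n = Vec (Fin (2 ℕ.* n)) (2 ℕ.* n)

IsMatching : ∀ {n} → Matching n → Set
IsMatching v = ∀ i → (lookup v (lookup v i) ≡ i) × (lookup v i ≢ i)

-- (a,c) gives a left-nesting: pairs (a,b),(c,d) in the matching with a<b, c<d,
-- c = a+1 and d < b  (so a < c < d < b).  b = v a, d = v c are determined.
IsLeftNesting : ∀ {n} → Matching n → Fin (2 ℕ.* n) × Fin (2 ℕ.* n) → Set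
IsLeftNesting v (a , c) =
  (toℕ c ≡ suc (toℕ a)) × (toℕ a < toℕ (lookup v a)) ×
  (toℕ c < toℕ (lookup v c)) × (toℕ (lookup v c) < toℕ (lookup v a))

isLeftNesting? : ∀ {n} (v : Matching n) (p : Fin (2 ℕ.* n) × Fin (2 ℕ.* n)) →
                 Dec (IsLeftNesting {n} v p)
isLeftNesting? v (a , c) =
  (toℕ c ℕ.≟ suc (toℕ a)) ×-dec ((toℕ a <? toℕ (lookup v a)) ×-dec
  ((toℕ c <? toℕ (lookup v c)) ×-dec (toℕ (lookup v c) <? toℕ (lookup v a))))

leftNestings : ∀ {n} → Matching n → ℕ
leftNestings {n} v =
  length (filter (isLeftNesting? {n} v) (cartesianProduct (allFin (2 ℕ.* n)) (allFin (2 ℕ.* n))))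

HasCount : {A : Set} → (A → Set) → ℕ → Set
HasCount {A} P N = Σ (List A) λ L → Unique L × (∀ x → (x ∈ L) ⇔ P x) × (length L ≡ N)

-- A matching is handled through its partner map f : ℕ → ℕ, a fixed-point-free
-- involution of [0, 2n).  Every matching on 2n + 2 points arises uniquely from one on
-- 2n points by opening a gap at some g ≤ 2n and pairing g with a new last point.
-- This insertion adds increment f g = [g opens an arc] - [(g - 1, g) is a
-- left-nesting] ∈ {0, 1} left-nestings, and summing over g, the increments add up to
-- n - (number of left-nestings of f).  So n - A of the 2n + 1 extensions of a
-- matching with A left-nestings have A + 1 of them and the other n + 1 + A keep A,
-- which gives count (n+1) j = (n + 1 + j) count n j + (n + 1 - j) count n (j - 1):
-- the recurrence of T (n + 1) (n + 1 - j).
module Submission where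

open import Defs
open import Data.Nat using (ℕ; zero; suc; pred; _+_; _*_; _∸_; _≤_; _<_; z≤n; s≤s; _<?_; _≟_; _≤?_)
open import Data.Nat.Properties
open import Data.Nat.Solver using (module +-*-Solver)
open import Data.Integer as ℤ using (+_; _-_)
import Data.Integer.Properties as ℤ
open import Data.Integer.Tactic.RingSolver using (solve-∀)
open import Data.Fin as Fin using (Fin; toℕ; fromℕ<)
open import Data.Fin.Properties using (toℕ-fromℕ<; fromℕ<-toℕ; toℕ-injective; toℕ<n)
open import Data.Vec using (Vec; lookup; tabulate)
open import Data.Vec.Properties using (lookup∘tabulate; tabulate∘lookup; tabulate-cong)
open import Data.List as List
  using (List; []; _∷_; _++_; map; length; filter; upTo; applyUpTo; allFin; cartesianProductWith; cartesianProduct)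
open import Data.List.Properties using (length-map)
open import Data.List.Membership.Propositional using (_∈_)
open import Data.List.Membership.Propositional.Properties
  using (∈-map⁺; ∈-map⁻; ∈-filter⁺; ∈-filter⁻; ∈-cartesianProductWith⁺; ∈-cartesianProductWith⁻; ∈-upTo⁺; ∈-upTo⁻)
open import Data.List.Relation.Unary.Any using (here; there)
import Data.List.Relation.Unary.All as All
import Data.List.Relation.Unary.All.Properties as All
open import Data.List.Relation.Unary.AllPairs using ([]; _∷_)
open import Data.List.Relation.Unary.Unique.Propositional using (Unique)
import Data.List.Relation.Unary.Unique.Propositional.Properties as Unique
open import Data.Product using (Σ; _×_; _,_; proj₁; proj₂)
open import Data.Sum using (inj₁; inj₂)
open import Data.Empty using (⊥-elim)
open import Function using (_∘_)
open import Function.Bundles using (_⇔_; mk⇔; Equivalence)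
open import Relation.Binary.PropositionalEquality
open import Relation.Nullary using (Dec; yes; no; ¬_)
open import Relation.Nullary.Decidable using (_×-dec_)
open import Relation.Unary using (Pred; Decidable)
open +-*-Solver using (solve; _:+_; _:=_; con)

χ : ∀ {p} {P : Set p} → Dec P → ℕ
χ (yes _) = 1
χ (no _)  = 0

χ-yes : ∀ {p} {P : Set p} (d : Dec P) → P → χ d ≡ 1
χ-yes (yes _) _ = refl
χ-yes (no ¬p) p = ⊥-elim (¬p p)

χ-no : ∀ {p} {P : Set p} (d : Dec P) → ¬ P → χ d ≡ 0
χ-no (yes p) ¬p = ⊥-elim (¬p p)
χ-no (no _)  _  = refl

χ≤1 : ∀ {p} {P : Set p} (d : Dec P) → χ d ≤ 1
χ≤1 (yes _) = s≤s z≤n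
χ≤1 (no _)  = z≤n

χ-mono : ∀ {p q} {P : Set p} {Q : Set q} (d : Dec P) (e : Dec Q) → (P → Q) → χ d ≤ χ e
χ-mono (yes p) e f = ≤-reflexive (sym (χ-yes e (f p)))
χ-mono (no _)  e f = z≤n

χ-cong : ∀ {p q} {P : Set p} {Q : Set q} (d : Dec P) (e : Dec Q) → (P → Q) → (Q → P) → χ d ≡ χ e
χ-cong d e f g = ≤-antisym (χ-mono d e f) (χ-mono e d g)

χ-≟-* : ∀ a b (h : ℕ → ℕ) → χ (a ≟ b) * h a ≡ χ (a ≟ b) * h b
χ-≟-* a b h with a ≟ b
... | yes refl = refl
... | no _     = refl

χ-× : ∀ {p q} {P : Set p} {Q : Set q} (d : Dec P) (e : Dec Q) → χ (d ×-dec e) ≡ χ d * χ e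
χ-× (yes _) (yes _) = refl
χ-× (yes _) (no _)  = refl
χ-× (no _)  _       = refl

∑< : ℕ → (ℕ → ℕ) → ℕ
∑< zero    h = 0
∑< (suc k) h = h 0 + ∑< k (h ∘ suc)

∑<-cong : ∀ k {h h' : ℕ → ℕ} → (∀ i → i < k → h i ≡ h' i) → ∑< k h ≡ ∑< k h'
∑<-cong zero    eq = refl
∑<-cong (suc k) eq = cong₂ _+_ (eq 0 (s≤s z≤n)) (∑<-cong k (λ i i<k → eq (suc i) (s≤s i<k)))

∑<-last : ∀ k h → ∑< (suc k) h ≡ ∑< k h + h k
∑<-last zero    h = +-comm (h 0) 0
∑<-last (suc k) h = trans (cong (_+_ (h 0)) (∑<-last k (h ∘ suc))) (sym (+-assoc (h 0) _ _))

∑<-+ : ∀ k h h' → ∑< k (λ i → h i + h' i) ≡ ∑< k h + ∑< k h'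
∑<-+ zero    h h' = refl
∑<-+ (suc k) h h' = begin
  (h 0 + h' 0) + ∑< k (λ i → h (suc i) + h' (suc i))
    ≡⟨ cong (_+_ (h 0 + h' 0)) (∑<-+ k (h ∘ suc) (h' ∘ suc)) ⟩
  (h 0 + h' 0) + (∑< k (h ∘ suc) + ∑< k (h' ∘ suc))
    ≡⟨ solve 4 (λ a b c d → (a :+ b) :+ (c :+ d) := (a :+ c) :+ (b :+ d)) refl
         (h 0) (h' 0) (∑< k (h ∘ suc)) (∑< k (h' ∘ suc)) ⟩
  (h 0 + ∑< k (h ∘ suc)) + (h' 0 + ∑< k (h' ∘ suc)) ∎
  where open ≡-Reasoning

∑<-*ˡ : ∀ k c h → ∑< k (λ i → c * h i) ≡ c * ∑< k h
∑<-*ˡ zero    c h = sym (*-zeroʳ c)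
∑<-*ˡ (suc k) c h = trans (cong (_+_ (c * h 0)) (∑<-*ˡ k c (h ∘ suc))) (sym (*-distribˡ-+ c (h 0) _))

∑<-ones : ∀ k → ∑< k (λ _ → 1) ≡ k
∑<-ones zero    = refl
∑<-ones (suc k) = cong suc (∑<-ones k)

∑<-except : ∀ k q {h h' : ℕ → ℕ} → q < k → (∀ i → i < k → i ≢ q → h' i ≡ h i) → h' q ≡ 0 →
            ∑< k h' + h q ≡ ∑< k h
∑<-except (suc k) zero {h} {h'} _ eq h'q = begin
  (h' 0 + ∑< k (h' ∘ suc)) + h 0 ≡⟨ cong (λ z → (z + ∑< k (h' ∘ suc)) + h 0) h'q ⟩
  ∑< k (h' ∘ suc) + h 0          ≡⟨ +-comm _ (h 0) ⟩
  h 0 + ∑< k (h' ∘ suc)          ≡⟨ cong (_+_ (h 0)) (∑<-cong k (λ i i<k → eq (suc i) (s≤s i<k) λ ())) ⟩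
  h 0 + ∑< k (h ∘ suc)           ∎
  where open ≡-Reasoning
∑<-except (suc k) (suc q) {h} {h'} (s≤s q<k) eq h'q = begin
  (h' 0 + ∑< k (h' ∘ suc)) + h (suc q) ≡⟨ +-assoc (h' 0) _ _ ⟩
  h' 0 + (∑< k (h' ∘ suc) + h (suc q)) ≡⟨ cong₂ _+_ (eq 0 (s≤s z≤n) λ ())
                                            (∑<-except k q q<k (λ i i<k i≢q → eq (suc i) (s≤s i<k) (i≢q ∘ suc-injective)) h'q) ⟩
  h 0 + ∑< k (h ∘ suc)                 ∎
  where open ≡-Reasoning

atPred : (ℕ → ℕ) → ℕ → ℕ
atPred h zero    = 0
atPred h (suc q) = h q

∑<-dropPred : ∀ k g {h h' : ℕ → ℕ} → g ≤ k → (∀ i → i < k → suc i ≢ g → h' i ≡ h i) →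
              (∀ q → suc q ≡ g → h' q ≡ 0) → ∑< k h' + atPred h g ≡ ∑< k h
∑<-dropPred k zero    _   eq _   = trans (+-identityʳ _) (∑<-cong k λ i i<k → eq i i<k λ ())
∑<-dropPred k (suc q) q<k eq h'q =
  ∑<-except k q q<k (λ i i<k i≢q → eq i i<k (i≢q ∘ suc-injective)) (h'q q refl)

∑<-zero : ∀ k h → (∀ i → i < k → h i ≡ 0) → ∑< k h ≡ 0
∑<-zero k h h≡0 = trans (∑<-cong k h≡0) (∑<-zero′ k)
  where ∑<-zero′ : ∀ k → ∑< k (λ _ → 0) ≡ 0
        ∑<-zero′ zero    = refl
        ∑<-zero′ (suc k) = ∑<-zero′ k

∑<-δ : ∀ k q → ∑< k (λ i → χ (i ≟ q)) ≡ χ (q <? k)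
∑<-δ zero    q       = sym (χ-no (q <? 0) λ ())
∑<-δ (suc k) zero    = cong suc (∑<-zero k _ λ i _ → χ-no (suc i ≟ 0) λ ())
∑<-δ (suc k) (suc q) = trans (∑<-cong k λ i _ → χ-cong (suc i ≟ suc q) (i ≟ q) suc-injective (cong suc))
                             (trans (∑<-δ k q) (χ-cong (q <? k) (suc q <? suc k) s≤s ≤-pred))

-- shift g inserts a gap at position g: it fixes x < g and moves x ≥ g up by one;
-- unshift g is its inverse away from the gap.
shift : ℕ → ℕ → ℕ
shift zero    x       = suc x
shift (suc g) zero    = zero
shift (suc g) (suc x) = suc (shift g x)

unshift : ℕ → ℕ → ℕ
unshift zero    x       = pred x
unshift (suc g) zero    = zero
unshift (suc g) (suc x) = suc (unshift g x)

shift-< : ∀ {g x} → x < g → shift g x ≡ x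
shift-< {suc g} {zero}  _         = refl
shift-< {suc g} {suc x} (s≤s x<g) = cong suc (shift-< x<g)

shift-≥ : ∀ {g x} → g ≤ x → shift g x ≡ suc x
shift-≥ {zero}              _         = refl
shift-≥ {suc g} {suc x} (s≤s g≤x) = cong suc (shift-≥ g≤x)

shift≢gap : ∀ g x → shift g x ≢ g
shift≢gap zero    x       ()
shift≢gap (suc g) zero    ()
shift≢gap (suc g) (suc x) e = shift≢gap g x (suc-injective e)

shift≤suc : ∀ g x → shift g x ≤ suc x
shift≤suc zero    x       = ≤-refl
shift≤suc (suc g) zero    = z≤n
shift≤suc (suc g) (suc x) = s≤s (shift≤suc g x)

unshift-shift : ∀ g x → unshift g (shift g x) ≡ x
unshift-shift zero    x       = refl
unshift-shift (suc g) zero    = refl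
unshift-shift (suc g) (suc x) = cong suc (unshift-shift g x)

shift-unshift : ∀ g x → x ≢ g → shift g (unshift g x) ≡ x
shift-unshift zero    zero    x≢g = ⊥-elim (x≢g refl)
shift-unshift zero    (suc x) _   = refl
shift-unshift (suc g) zero    _   = refl
shift-unshift (suc g) (suc x) x≢g = cong suc (shift-unshift g x (x≢g ∘ cong suc))

shift-injective : ∀ g {x y} → shift g x ≡ shift g y → x ≡ y
shift-injective g {x} {y} e = trans (sym (unshift-shift g x)) (trans (cong (unshift g) e) (unshift-shift g y))

shift-mono : ∀ g {x y} → x < y → shift g x < shift g y
shift-mono zero    x<y                = s≤s x<y
shift-mono (suc g) {zero}  {suc y} _  = s≤s z≤n
shift-mono (suc g) {suc x} {suc y} (s≤s x<y) = s≤s (shift-mono g x<y)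

shift-cancel : ∀ g {x y} → shift g x < shift g y → x < y
shift-cancel zero    (s≤s x<y)               = x<y
shift-cancel (suc g) {zero}  {suc y} _       = s≤s z≤n
shift-cancel (suc g) {suc x} {suc y} (s≤s l) = s≤s (shift-cancel g l)

shift-suc : ∀ g p → suc p ≢ g → shift g (suc p) ≡ suc (shift g p)
shift-suc zero          p       _ = refl
shift-suc (suc zero)    zero    e = ⊥-elim (e refl)
shift-suc (suc (suc g)) zero    _ = refl
shift-suc (suc g)       (suc p) e = cong suc (shift-suc g p (e ∘ cong suc))

shift<suc : ∀ g {x m} → x < m → shift g x < suc m
shift<suc g {x} x<m = s≤s (≤-trans (shift≤suc g x) x<m)

unshift-< : ∀ {g m x} → g ≤ m → x < suc m → x ≢ g → unshift g x < m
unshift-< {zero}  {m}     {zero}  _         _          x≢g = ⊥-elim (x≢g refl)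
unshift-< {zero}  {m}     {suc x} _         (s≤s x<m)  _   = x<m
unshift-< {suc g} {suc m} {zero}  _         _          _   = s≤s z≤n
unshift-< {suc g} {suc m} {suc x} (s≤s g≤m) (s≤s x<sm) x≢g = s≤s (unshift-< g≤m x<sm (x≢g ∘ cong suc))

∑<-gap : ∀ m g h → g ≤ m → ∑< (suc m) h ≡ ∑< m (h ∘ shift g) + h g
∑<-gap m       zero    h _         = +-comm (h 0) _
∑<-gap (suc m) (suc g) h (s≤s g≤m) =
  trans (cong (_+_ (h 0)) (∑<-gap m g (h ∘ suc) g≤m)) (sym (+-assoc (h 0) _ _))

∑<-insert : ∀ m g h → g ≤ m → ∑< (suc (suc m)) h ≡ ∑< m (h ∘ shift g) + h g + h (suc m)
∑<-insert m g h g≤m = trans (∑<-last (suc m) h) (cong (_+ h (suc m)) (∑<-gap m g h g≤m))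

-- f is the partner map of a matching on the points [0, m): a fixed-point-free
-- involution of [0, m).
IsPairing : ℕ → (ℕ → ℕ) → Set
IsPairing m f = ∀ x → x < m → (f x < m) × (f (f x) ≡ x) × (f x ≢ x)

-- The matching on m + 2 points obtained from f (on m points) by opening a gap at
-- g ≤ m and adding the arc (g, m + 1) ending at the new last point.
insertArc : ℕ → (ℕ → ℕ) → ℕ → ℕ → ℕ
insertArc m f g x with x ≟ suc m
... | yes _ = g
... | no _ with x ≟ g
...   | yes _ = suc m
...   | no _  = shift g (f (unshift g x))

insertArc-top : ∀ m f g → insertArc m f g (suc m) ≡ g
insertArc-top m f g with suc m ≟ suc m
... | yes _ = refl
... | no ¬p = ⊥-elim (¬p refl)

insertArc-gap : ∀ m f g → g ≤ m → insertArc m f g g ≡ suc m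
insertArc-gap m f g g≤m with g ≟ suc m
... | yes e = ⊥-elim (<-irrefl e (s≤s g≤m))
... | no _ with g ≟ g
...   | yes _ = refl
...   | no ¬p = ⊥-elim (¬p refl)

insertArc-shift : ∀ m f g p → p < m → insertArc m f g (shift g p) ≡ shift g (f p)
insertArc-shift m f g p p<m with shift g p ≟ suc m
... | yes e = ⊥-elim (<-irrefl e (shift<suc g p<m))
... | no _ with shift g p ≟ g
...   | yes e = ⊥-elim (shift≢gap g p e)
...   | no _  = cong (shift g ∘ f) (unshift-shift g p)

data InsertedPoint (m g : ℕ) : ℕ → Set where
  top : InsertedPoint m g (suc m)
  gap : InsertedPoint m g g
  old : ∀ p → p < m → InsertedPoint m g (shift g p)

insertedPoint : ∀ {g m x} → g ≤ m → x < suc (suc m) → InsertedPoint m g x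
insertedPoint {g} {m} {x} g≤m x<ssm with x ≟ suc m | x ≟ g
... | yes refl | _      = top
... | no _     | yes refl = gap
... | no x≢sm  | no x≢g =
  subst (InsertedPoint m g) (shift-unshift g x x≢g)
        (old (unshift g x) (unshift-< g≤m (≤∧≢⇒< (≤-pred x<ssm) x≢sm) x≢g))

insertArc-pairing : ∀ {m f g} → IsPairing m f → g ≤ m → IsPairing (suc (suc m)) (insertArc m f g)
insertArc-pairing {m} {f} {g} P g≤m x x<ssm with insertedPoint g≤m x<ssm
... | top rewrite insertArc-top m f g | insertArc-gap m f g g≤m =
  m<n⇒m<1+n (s≤s g≤m) , refl , λ e → <-irrefl e (s≤s g≤m)
... | gap rewrite insertArc-gap m f g g≤m | insertArc-top m f g =
  ≤-refl , refl , λ e → <-irrefl (sym e) (s≤s g≤m)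
... | old p p<m with P p p<m
...   | fp<m , ffp≡p , fp≢p
  rewrite insertArc-shift m f g p p<m | insertArc-shift m f g (f p) fp<m | ffp≡p =
  m<n⇒m<1+n (shift<suc g fp<m) , refl , fp≢p ∘ shift-injective g

-- Conversely, deleting the arc at the last point m + 1 of a matching on m + 2 points.
removeTop : ℕ → (ℕ → ℕ) → ℕ → ℕ
removeTop m f p = unshift (f (suc m)) (f (shift (f (suc m)) p))

module RemoveTop {m f} (P : IsPairing (suc (suc m)) f) where

  g : ℕ
  g = f (suc m)

  g<sm : g < suc m
  g<sm = ≤∧≢⇒< (≤-pred (proj₁ (P (suc m) ≤-refl))) (proj₂ (proj₂ (P (suc m) ≤-refl)))

  partner-g : f g ≡ suc m
  partner-g = proj₁ (proj₂ (P (suc m) ≤-refl))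

  module _ (p : ℕ) (p<m : p < m) where
    private
      x<ssm : shift g p < suc (suc m)
      x<ssm = m<n⇒m<1+n (shift<suc g p<m)
      Px = P (shift g p) x<ssm

    partner≢g : f (shift g p) ≢ g
    partner≢g e = <⇒≢ (shift<suc g p<m)
      (trans (sym (proj₁ (proj₂ Px))) (trans (cong f e) partner-g))

    partner<sm : f (shift g p) < suc m
    partner<sm = ≤∧≢⇒< (≤-pred (proj₁ Px))
      (λ e → shift≢gap g p (trans (sym (proj₁ (proj₂ Px))) (cong f e)))

    shift-removeTop : shift g (removeTop m f p) ≡ f (shift g p)
    shift-removeTop = shift-unshift g _ partner≢g

  removeTop-pairing : IsPairing m (removeTop m f)
  removeTop-pairing p p<m =
    unshift-< (≤-pred g<sm) (partner<sm p p<m) (partner≢g p p<m) ,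
    (begin
      unshift g (f (shift g (removeTop m f p))) ≡⟨ cong (unshift g ∘ f) (shift-removeTop p p<m) ⟩
      unshift g (f (f (shift g p)))             ≡⟨ cong (unshift g) (proj₁ (proj₂ (P _ x<ssm))) ⟩
      unshift g (shift g p)                     ≡⟨ unshift-shift g p ⟩
      p                                         ∎) ,
    λ e → proj₂ (proj₂ (P _ x<ssm)) (trans (sym (shift-removeTop p p<m)) (cong (shift g) e))
    where open ≡-Reasoning
          x<ssm = m<n⇒m<1+n (shift<suc g p<m)

  insertArc-removeTop : ∀ {f₀} → (∀ p → p < m → f₀ p ≡ removeTop m f p) →
                        ∀ x → x < suc (suc m) → insertArc m f₀ g x ≡ f x
  insertArc-removeTop agree x x<ssm with insertedPoint (≤-pred g<sm) x<ssm
  ... | top       = insertArc-top m _ g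
  ... | gap       = trans (insertArc-gap m _ g (≤-pred g<sm)) (sym partner-g)
  ... | old p p<m = trans (insertArc-shift m _ g p p<m)
                      (trans (cong (shift g) (agree p p<m)) (shift-removeTop p p<m))

IsNestAt : (ℕ → ℕ) → ℕ → ℕ → Set
IsNestAt f m a = (suc a < m) × (a < f a) × (suc a < f (suc a)) × (f (suc a) < f a)

isNestAt? : ∀ f m a → Dec (IsNestAt f m a)
isNestAt? f m a = suc a <? m ×-dec (a <? f a ×-dec (suc a <? f (suc a) ×-dec f (suc a) <? f a))

nestAt : (ℕ → ℕ) → ℕ → ℕ → ℕ
nestAt f m a = χ (isNestAt? f m a)

IsOpenAt : (ℕ → ℕ) → ℕ → ℕ → Set
IsOpenAt f m a = (a < m) × (a < f a)

isOpenAt? : ∀ f m a → Dec (IsOpenAt f m a)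
isOpenAt? f m a = a <? m ×-dec a <? f a

openAt : (ℕ → ℕ) → ℕ → ℕ → ℕ
openAt f m a = χ (isOpenAt? f m a)

nestBefore : (ℕ → ℕ) → ℕ → ℕ → ℕ
nestBefore f m = atPred (nestAt f m)

nestBefore≤openAt : ∀ f m g → nestBefore f m g ≤ openAt f m g
nestBefore≤openAt f m zero    = z≤n
nestBefore≤openAt f m (suc g) = χ-mono _ _ λ { (g<m , _ , g<fg , _) → g<m , g<fg }

openAt-outside : ∀ f m → openAt f m m ≡ 0
openAt-outside f m = χ-no _ (<-irrefl refl ∘ proj₁)

-- The change in the number of left-nestings when the arc (g, m + 1) is inserted.
increment : (ℕ → ℕ) → ℕ → ℕ → ℕ
increment f m g = openAt f m g ∸ nestBefore f m g

increment≤1 : ∀ f m g → increment f m g ≤ 1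
increment≤1 f m g = ≤-trans (m∸n≤m (openAt f m g) (nestBefore f m g)) (χ≤1 (isOpenAt? f m g))

-- Every left-nesting is counted once by nestBefore, so the increments over all
-- gap positions add up to (number of arcs) - (number of left-nestings).
increments-sum : ∀ f m → ∑< (suc m) (increment f m) + ∑< m (nestAt f m) ≡ ∑< m (openAt f m)
increments-sum f m = begin
  ∑< (suc m) (increment f m) + ∑< (suc m) (nestBefore f m)
    ≡⟨ sym (∑<-+ (suc m) (increment f m) (nestBefore f m)) ⟩
  ∑< (suc m) (λ g → increment f m g + nestBefore f m g)
    ≡⟨ ∑<-cong (suc m) (λ g _ → m∸n+n≡m (nestBefore≤openAt f m g)) ⟩
  ∑< (suc m) (openAt f m)
    ≡⟨ trans (∑<-last m (openAt f m)) (cong (_+_ (∑< m (openAt f m))) (openAt-outside f m)) ⟩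
  ∑< m (openAt f m) + 0
    ≡⟨ +-identityʳ _ ⟩
  ∑< m (openAt f m) ∎
  where open ≡-Reasoning

module Insert (m : ℕ) (f : ℕ → ℕ) (g : ℕ) (P : IsPairing m f) (g≤m : g ≤ m) where

  f' : ℕ → ℕ
  f' = insertArc m f g

  openAt-old : ∀ p → p < m → openAt f' (suc (suc m)) (shift g p) ≡ openAt f m p
  openAt-old p p<m = χ-cong _ _
    (λ { (_ , x) → p<m , shift-cancel g (subst (shift g p <_) e x) })
    (λ { (_ , x) → m<n⇒m<1+n (shift<suc g p<m) , subst (shift g p <_) (sym e) (shift-mono g x) })
    where e = insertArc-shift m f g p p<m

  openAt-gap : openAt f' (suc (suc m)) g ≡ 1
  openAt-gap = χ-yes _ (m<n⇒m<1+n (s≤s g≤m) , subst (g <_) (sym (insertArc-gap m f g g≤m)) (s≤s g≤m))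

  openAt-top : openAt f' (suc (suc m)) (suc m) ≡ 0
  openAt-top = χ-no _ λ (_ , x) → <⇒≱ (subst (suc m <_) (insertArc-top m f g) x) (m≤n⇒m≤1+n g≤m)

  nestAt-old : ∀ p → p < m → suc p ≢ g → nestAt f' (suc (suc m)) (shift g p) ≡ nestAt f m p
  nestAt-old p p<m sp≢g with m≤n⇒m<n∨m≡n p<m
  ... | inj₁ sp<m = χ-cong _ _
    (λ { (_ , x , y , z) → sp<m , shift-cancel g (subst (a <_) e₀ x) ,
           shift-cancel g (subst₂ _<_ (sym eq) e₁ y) , shift-cancel g (subst₂ _<_ e₁ e₀ z) })
    (λ { (_ , x , y , z) → subst (_< suc (suc m)) eq (m<n⇒m<1+n (shift<suc g sp<m)) ,
           subst (a <_) (sym e₀) (shift-mono g x) , subst₂ _<_ eq (sym e₁) (shift-mono g y) ,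
           subst₂ _<_ (sym e₁) (sym e₀) (shift-mono g z) })
    where
      a = shift g p
      eq : shift g (suc p) ≡ suc a
      eq = shift-suc g p sp≢g
      e₀ : f' a ≡ shift g (f p)
      e₀ = insertArc-shift m f g p p<m
      e₁ : f' (suc a) ≡ shift g (f (suc p))
      e₁ = trans (cong f' (sym eq)) (insertArc-shift m f g (suc p) sp<m)
  ... | inj₂ sp≡m = trans (χ-no (isNestAt? f' (suc (suc m)) a) (λ (_ , _ , y , _) → <⇒≱ (subst (suc a <_) top-partner y) g≤a))
                        (sym (χ-no (isNestAt? f m p) (<-irrefl sp≡m ∘ proj₁)))
    where
      a = shift g p
      g≤p : g ≤ p
      g≤p = ≤-pred (≤∧≢⇒< (subst (g ≤_) (sym sp≡m) g≤m) (sp≢g ∘ sym))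
      top-partner : f' (suc a) ≡ g
      top-partner = trans (cong (f' ∘ suc) (trans (shift-≥ g≤p) sp≡m)) (insertArc-top m f g)
      g≤a : g ≤ suc a
      g≤a = subst (g ≤_) (cong suc (sym (shift-≥ g≤p))) (m≤n⇒m≤1+n (m≤n⇒m≤1+n g≤p))

  -- (g - 1, g) is no left-nesting any more: the partner m + 1 of g is the largest point
  nestAt-beforeGap : ∀ q → suc q ≡ g → nestAt f' (suc (suc m)) q ≡ 0
  nestAt-beforeGap q sq≡g = χ-no (isNestAt? f' (suc (suc m)) q) λ (_ , _ , _ , z) →
    <-asym (subst₂ _<_ (trans (cong f' sq≡g) (insertArc-gap m f g g≤m)) e z)
           (shift<suc g (proj₁ (P q q<m)))
    where
      q<m : q < m
      q<m = <-≤-trans (subst (q <_) sq≡g ≤-refl) g≤m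
      e : f' q ≡ shift g (f q)
      e = trans (cong f' (sym (shift-< (subst (q <_) sq≡g ≤-refl)))) (insertArc-shift m f g q q<m)

  -- the new arc (g, m + 1) contains the arc opened at g + 1, if any
  nestAt-gap : nestAt f' (suc (suc m)) g ≡ openAt f m g
  nestAt-gap with m≤n⇒m<n∨m≡n g≤m
  ... | inj₁ g<m = χ-cong _ _
    (λ { (_ , _ , y , _) → g<m , shift-cancel g (subst₂ _<_ e₀ e₁ y) })
    (λ { (_ , y) → s≤s (m<n⇒m<1+n g<m) , subst (g <_) (sym (insertArc-gap m f g g≤m)) (m<n⇒m<1+n g<m) ,
                   subst₂ _<_ (sym e₀) (sym e₁) (shift-mono g y) ,
                   subst₂ _<_ (sym e₁) (sym (insertArc-gap m f g g≤m)) (shift<suc g (proj₁ (P g g<m))) })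
    where
      e₀ : suc g ≡ shift g g
      e₀ = sym (shift-≥ ≤-refl)
      e₁ : f' (suc g) ≡ shift g (f g)
      e₁ = trans (cong f' e₀) (insertArc-shift m f g g g<m)
  ... | inj₂ refl = trans
    (χ-no (isNestAt? f' (suc (suc m)) m) λ (_ , _ , y , _) → <-asym y (subst (_< suc m) (sym (insertArc-top m f m)) ≤-refl))
    (sym (openAt-outside f m))

  nestAt-top : nestAt f' (suc (suc m)) (suc m) ≡ 0
  nestAt-top = χ-no (isNestAt? f' (suc (suc m)) (suc m)) (<-irrefl refl ∘ proj₁)

  openers-insertArc : ∑< (suc (suc m)) (openAt f' (suc (suc m))) ≡ suc (∑< m (openAt f m))
  openers-insertArc = begin
    ∑< (suc (suc m)) O'                          ≡⟨ ∑<-insert m g O' g≤m ⟩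
    ∑< m (O' ∘ shift g) + O' g + O' (suc m)      ≡⟨ cong₂ (λ x y → x + y + O' (suc m)) (∑<-cong m openAt-old) openAt-gap ⟩
    ∑< m (openAt f m) + 1 + O' (suc m)           ≡⟨ cong (_+_ (∑< m (openAt f m) + 1)) openAt-top ⟩
    ∑< m (openAt f m) + 1 + 0                    ≡⟨ trans (+-identityʳ _) (+-comm _ 1) ⟩
    suc (∑< m (openAt f m))                      ∎
    where open ≡-Reasoning
          O' = openAt f' (suc (suc m))

  nestings-old : ∑< m (nestAt f' (suc (suc m)) ∘ shift g) + nestBefore f m g ≡ ∑< m (nestAt f m)
  nestings-old = ∑<-dropPred m g g≤m (λ p p<m sp≢g → nestAt-old p p<m sp≢g)
    λ q sq≡g → trans (cong (nestAt f' (suc (suc m))) (shift-< (subst (q <_) sq≡g ≤-refl))) (nestAt-beforeGap q sq≡g)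

  nestings-insertArc : ∑< (suc (suc m)) (nestAt f' (suc (suc m))) + nestBefore f m g
                     ≡ ∑< m (nestAt f m) + openAt f m g
  nestings-insertArc = begin
    ∑< (suc (suc m)) t' + B                        ≡⟨ cong (_+ B) (∑<-insert m g t' g≤m) ⟩
    ∑< m (t' ∘ shift g) + t' g + t' (suc m) + B    ≡⟨ cong₂ (λ x y → ∑< m (t' ∘ shift g) + x + y + B) nestAt-gap nestAt-top ⟩
    ∑< m (t' ∘ shift g) + openAt f m g + 0 + B     ≡⟨ solve 3 (λ x o b → x :+ o :+ con 0 :+ b := x :+ b :+ o) refl
                                                         (∑< m (t' ∘ shift g)) (openAt f m g) B ⟩
    ∑< m (t' ∘ shift g) + B + openAt f m g         ≡⟨ cong (_+ openAt f m g) nestings-old ⟩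
    ∑< m (nestAt f m) + openAt f m g               ∎
    where open ≡-Reasoning
          t' = nestAt f' (suc (suc m))
          B  = nestBefore f m g

  nestings-step : ∑< (suc (suc m)) (nestAt f' (suc (suc m))) ≡ ∑< m (nestAt f m) + increment f m g
  nestings-step = +-cancelʳ-≡ (nestBefore f m g) _ _ (begin
    ∑< (suc (suc m)) (nestAt f' (suc (suc m))) + B ≡⟨ nestings-insertArc ⟩
    ∑< m (nestAt f m) + openAt f m g                ≡⟨ cong (_+_ (∑< m (nestAt f m))) (sym (m∸n+n≡m (nestBefore≤openAt f m g))) ⟩
    ∑< m (nestAt f m) + (increment f m g + B)       ≡⟨ sym (+-assoc (∑< m (nestAt f m)) (increment f m g) B) ⟩
    ∑< m (nestAt f m) + increment f m g + B         ∎)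
    where open ≡-Reasoning
          B = nestBefore f m g

-- 2n, by a recursion that makes dbl (suc n) = suc (suc (dbl n)) hold definitionally.
dbl : ℕ → ℕ
dbl zero    = 0
dbl (suc n) = suc (suc (dbl n))

dbl≡+ : ∀ n → dbl n ≡ n + n
dbl≡+ zero    = refl
dbl≡+ (suc n) = cong suc (trans (cong suc (dbl≡+ n)) (sym (+-suc n n)))

-- A code of a matching on 2n points is a list g_n ∷ ⋯ ∷ g_1 with g_k ≤ 2k - 2: the
-- matching is built by n successive insertions of an arc ending at the last point.
Codes : ℕ → List (List ℕ)
Codes zero    = [] ∷ []
Codes (suc n) = cartesianProductWith (λ c g → g ∷ c) (Codes n) (upTo (suc (dbl n)))

decode : ℕ → List ℕ → ℕ → ℕ
decode (suc n) (g ∷ c) = insertArc (dbl n) (decode n c) g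
decode _       _       = λ _ → 0

Codes-unique : ∀ n → Unique (Codes n)
Codes-unique zero    = All.[] ∷ []
Codes-unique (suc n) = Unique.cartesianProductWith⁺ (λ c g → g ∷ c) (λ { refl → refl , refl })
                         (Codes-unique n) (Unique.upTo⁺ (suc (dbl n)))

data CodeStep (n : ℕ) : List ℕ → Set where
  step : ∀ {c} g → g ≤ dbl n → c ∈ Codes n → CodeStep n (g ∷ c)

codeStep : ∀ n {c} → c ∈ Codes (suc n) → CodeStep n c
codeStep n c∈ with ∈-cartesianProductWith⁻ (λ c g → g ∷ c) (Codes n) (upTo (suc (dbl n))) c∈
... | c' , g , c'∈ , g∈ , refl = step g (≤-pred (∈-upTo⁻ g∈)) c'∈

nestings : ℕ → List ℕ → ℕ
nestings n c = ∑< (dbl n) (nestAt (decode n c) (dbl n))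

decode-pairing : ∀ n {c} → c ∈ Codes n → IsPairing (dbl n) (decode n c)
decode-pairing zero    c∈ x ()
decode-pairing (suc n) c∈ with codeStep n c∈
... | step g g≤ c∈' = insertArc-pairing (decode-pairing n c∈') g≤

decode-openers : ∀ n {c} → c ∈ Codes n → ∑< (dbl n) (openAt (decode n c) (dbl n)) ≡ n
decode-openers zero    c∈ = refl
decode-openers (suc n) c∈ with codeStep n c∈
... | step {c} g g≤ c∈' = trans (Insert.openers-insertArc (dbl n) (decode n c) g (decode-pairing n c∈') g≤)
                                (cong suc (decode-openers n c∈'))

decode-surjective : ∀ n f → IsPairing (dbl n) f →
  Σ (List ℕ) λ c → (c ∈ Codes n) × (∀ x → x < dbl n → decode n c x ≡ f x)
decode-surjective zero    f P = [] , here refl , λ x ()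
decode-surjective (suc n) f P with decode-surjective n (removeTop (dbl n) f) (RemoveTop.removeTop-pairing P)
... | c , c∈ , agrees = g ∷ c , ∈-cartesianProductWith⁺ (λ c g → g ∷ c) c∈ (∈-upTo⁺ g<sm) ,
                         insertArc-removeTop agrees
  where open RemoveTop P

decode-injective : ∀ n {c c'} → c ∈ Codes n → c' ∈ Codes n →
  (∀ x → x < dbl n → decode n c x ≡ decode n c' x) → c ≡ c'
decode-injective zero    (here refl) (here refl) _ = refl
decode-injective (suc n) c∈ c'∈ agree with codeStep n c∈ | codeStep n c'∈
... | step {c} g _ c∈' | step {c'} g' _ c'∈' = cong₂ _∷_ g≡g' (decode-injective n c∈' c'∈' agree-old)
  where
    m = dbl n
    g≡g' : g ≡ g'
    g≡g' = trans (sym (insertArc-top m _ g)) (trans (agree (suc m) ≤-refl) (insertArc-top m _ g'))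
    agree-old : ∀ p → p < m → decode n c p ≡ decode n c' p
    agree-old p p<m = shift-injective g (begin
      shift g (decode n c p)             ≡⟨ sym (insertArc-shift m _ g p p<m) ⟩
      insertArc m (decode n c) g (shift g p)  ≡⟨ agree (shift g p) (m<n⇒m<1+n (shift<suc g p<m)) ⟩
      insertArc m (decode n c') g' (shift g p) ≡⟨ cong (λ z → insertArc m (decode n c') g' (shift z p)) g≡g' ⟩
      insertArc m (decode n c') g' (shift g' p) ≡⟨ insertArc-shift m _ g' p p<m ⟩
      shift g' (decode n c' p)           ≡⟨ cong (λ z → shift z (decode n c' p)) (sym g≡g') ⟩
      shift g (decode n c' p)            ∎)
      where open ≡-Reasoning

sumOver : ∀ {a} {A : Set a} → List A → (A → ℕ) → ℕ
sumOver []       h = 0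
sumOver (x ∷ xs) h = h x + sumOver xs h

module _ {a} {A : Set a} where

  sumOver-cong : ∀ (xs : List A) {h h' : A → ℕ} → (∀ x → x ∈ xs → h x ≡ h' x) → sumOver xs h ≡ sumOver xs h'
  sumOver-cong []       eq = refl
  sumOver-cong (x ∷ xs) eq = cong₂ _+_ (eq x (here refl)) (sumOver-cong xs (λ y y∈ → eq y (there y∈)))

  sumOver-zero : ∀ (xs : List A) → sumOver xs (λ _ → 0) ≡ 0
  sumOver-zero []       = refl
  sumOver-zero (x ∷ xs) = sumOver-zero xs

  sumOver-+ : ∀ (xs : List A) h h' → sumOver xs (λ x → h x + h' x) ≡ sumOver xs h + sumOver xs h'
  sumOver-+ []       h h' = refl
  sumOver-+ (x ∷ xs) h h' = trans (cong (_+_ (h x + h' x)) (sumOver-+ xs h h'))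
    (solve 4 (λ a b c d → (a :+ b) :+ (c :+ d) := (a :+ c) :+ (b :+ d)) refl (h x) (h' x) (sumOver xs h) (sumOver xs h'))

  sumOver-*ʳ : ∀ (xs : List A) h c → sumOver xs (λ x → h x * c) ≡ sumOver xs h * c
  sumOver-*ʳ []       h c = refl
  sumOver-*ʳ (x ∷ xs) h c = trans (cong (_+_ (h x * c)) (sumOver-*ʳ xs h c)) (sym (*-distribʳ-+ c (h x) _))

  sumOver-++ : ∀ (xs ys : List A) h → sumOver (xs ++ ys) h ≡ sumOver xs h + sumOver ys h
  sumOver-++ []       ys h = refl
  sumOver-++ (x ∷ xs) ys h = trans (cong (_+_ (h x)) (sumOver-++ xs ys h)) (sym (+-assoc (h x) _ _))

  length-filter : ∀ {p} {P : Pred A p} (P? : Decidable P) xs → length (filter P? xs) ≡ sumOver xs (χ ∘ P?)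
  length-filter P? []       = refl
  length-filter P? (x ∷ xs) with P? x
  ... | yes _ = cong suc (length-filter P? xs)
  ... | no _  = length-filter P? xs

sumOver-map : ∀ {a b} {A : Set a} {B : Set b} (f : A → B) xs h → sumOver (map f xs) h ≡ sumOver xs (h ∘ f)
sumOver-map f []       h = refl
sumOver-map f (x ∷ xs) h = cong (_+_ (h (f x))) (sumOver-map f xs h)

sumOver-cartesianProductWith : ∀ {a b c} {A : Set a} {B : Set b} {C : Set c} (f : A → B → C) xs ys h →
  sumOver (cartesianProductWith f xs ys) h ≡ sumOver xs (λ x → sumOver ys (h ∘ f x))
sumOver-cartesianProductWith f []       ys h = refl
sumOver-cartesianProductWith f (x ∷ xs) ys h =
  trans (sumOver-++ (map (f x) ys) _ h)
        (cong₂ _+_ (sumOver-map (f x) ys h) (sumOver-cartesianProductWith f xs ys h))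

sumOver-applyUpTo : ∀ {b} {B : Set b} (f : ℕ → B) k h → sumOver (applyUpTo f k) h ≡ ∑< k (h ∘ f)
sumOver-applyUpTo f zero    h = refl
sumOver-applyUpTo f (suc k) h = cong (_+_ (h (f 0))) (sumOver-applyUpTo (f ∘ suc) k h)

sumOver-tabulate : ∀ {a} {A : Set a} k (g : Fin k → A) h (ψ : ℕ → ℕ) → (∀ i → h (g i) ≡ ψ (toℕ i)) →
                   sumOver (List.tabulate g) h ≡ ∑< k ψ
sumOver-tabulate zero    g h ψ eq = refl
sumOver-tabulate (suc k) g h ψ eq =
  cong₂ _+_ (eq Fin.zero) (sumOver-tabulate k (g ∘ Fin.suc) h (ψ ∘ suc) (eq ∘ Fin.suc))

sumOver-allFin : ∀ k (h : ℕ → ℕ) → sumOver (allFin k) (h ∘ toℕ) ≡ ∑< k h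
sumOver-allFin k h = sumOver-tabulate k (λ i → i) (h ∘ toℕ) h (λ _ → refl)

χ-01 : ∀ A d j → d ≤ 1 → χ (A + d ≟ j) ≡ χ (A ≟ j) * (1 ∸ d) + χ (suc A ≟ j) * d
χ-01 A zero       j z≤n = begin
  χ (A + 0 ≟ j)                              ≡⟨ cong (λ z → χ (z ≟ j)) (+-identityʳ A) ⟩
  χ (A ≟ j)                                  ≡⟨ sym (trans (+-identityʳ _) (*-identityʳ _)) ⟩
  χ (A ≟ j) * 1 + 0                          ≡⟨ cong (_+_ (χ (A ≟ j) * 1)) (sym (*-zeroʳ (χ (suc A ≟ j)))) ⟩
  χ (A ≟ j) * 1 + χ (suc A ≟ j) * 0          ∎
  where open ≡-Reasoning
χ-01 A (suc zero) j (s≤s z≤n) = begin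
  χ (A + 1 ≟ j)                              ≡⟨ cong (λ z → χ (z ≟ j)) (+-comm A 1) ⟩
  χ (suc A ≟ j)                              ≡⟨ sym (*-identityʳ _) ⟩
  χ (suc A ≟ j) * 1                          ≡⟨ cong (_+ χ (suc A ≟ j) * 1) (sym (*-zeroʳ (χ (A ≟ j)))) ⟩
  χ (A ≟ j) * 0 + χ (suc A ≟ j) * 1          ∎
  where open ≡-Reasoning

∑<-χ-01 : ∀ k A j (D : ℕ → ℕ) → (∀ i → D i ≤ 1) →
  ∑< k (λ i → χ (A + D i ≟ j)) ≡ χ (A ≟ j) * ∑< k (λ i → 1 ∸ D i) + χ (suc A ≟ j) * ∑< k D
∑<-χ-01 k A j D D≤1 = begin
  ∑< k (λ i → χ (A + D i ≟ j))
    ≡⟨ ∑<-cong k (λ i _ → χ-01 A (D i) j (D≤1 i)) ⟩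
  ∑< k (λ i → χ (A ≟ j) * (1 ∸ D i) + χ (suc A ≟ j) * D i)
    ≡⟨ ∑<-+ k (λ i → χ (A ≟ j) * (1 ∸ D i)) (λ i → χ (suc A ≟ j) * D i) ⟩
  ∑< k (λ i → χ (A ≟ j) * (1 ∸ D i)) + ∑< k (λ i → χ (suc A ≟ j) * D i)
    ≡⟨ cong₂ _+_ (∑<-*ˡ k (χ (A ≟ j)) (λ i → 1 ∸ D i)) (∑<-*ˡ k (χ (suc A ≟ j)) D) ⟩
  χ (A ≟ j) * ∑< k (λ i → 1 ∸ D i) + χ (suc A ≟ j) * ∑< k D ∎
  where open ≡-Reasoning

∑<-complement : ∀ k (D : ℕ → ℕ) → (∀ i → D i ≤ 1) → ∑< k (λ i → 1 ∸ D i) + ∑< k D ≡ k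
∑<-complement k D D≤1 =
  trans (sym (∑<-+ k (λ i → 1 ∸ D i) D)) (trans (∑<-cong k (λ i _ → m∸n+n≡m (D≤1 i))) (∑<-ones k))

count : ℕ → ℕ → ℕ
count n j = length (filter (λ c → nestings n c ≟ j) (Codes n))

module Extensions (n : ℕ) {c : List ℕ} (c∈ : c ∈ Codes n) where

  private
    m = dbl n
    f = decode n c
    A = nestings n c
    D = increment f m

  nestings-extend : ∀ g → g ≤ m → nestings (suc n) (g ∷ c) ≡ A + D g
  nestings-extend g g≤m = Insert.nestings-step m f g (decode-pairing n c∈) g≤m

  increments-total : ∑< (suc m) D + A ≡ n
  increments-total = trans (increments-sum f m) (decode-openers n c∈)

  nestings≤n : A ≤ n
  nestings≤n = subst (A ≤_) increments-total (m≤n+m A _)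

  -- n - A of the 2n + 1 extensions gain a left-nesting, the other n + 1 + A keep A
  extensions-with : ∀ j → ∑< (suc m) (λ g → χ (nestings (suc n) (g ∷ c) ≟ j))
                        ≡ χ (A ≟ j) * (suc n + j) + χ (suc A ≟ j) * (suc n ∸ j)
  extensions-with j = begin
    ∑< (suc m) (λ g → χ (nestings (suc n) (g ∷ c) ≟ j))
      ≡⟨ ∑<-cong (suc m) (λ g g<sm → cong (λ z → χ (z ≟ j)) (nestings-extend g (≤-pred g<sm))) ⟩
    ∑< (suc m) (λ g → χ (A + D g ≟ j))
      ≡⟨ ∑<-χ-01 (suc m) A j D (increment≤1 f m) ⟩
    χ (A ≟ j) * X + χ (suc A ≟ j) * S
      ≡⟨ cong₂ (λ x y → χ (A ≟ j) * x + χ (suc A ≟ j) * y) X≡ S≡ ⟩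
    χ (A ≟ j) * (suc n + A) + χ (suc A ≟ j) * (suc n ∸ suc A)
      ≡⟨ cong₂ _+_ (χ-≟-* A j (_+_ (suc n))) (χ-≟-* (suc A) j (suc n ∸_)) ⟩
    χ (A ≟ j) * (suc n + j) + χ (suc A ≟ j) * (suc n ∸ j) ∎
    where
      open ≡-Reasoning
      X = ∑< (suc m) (λ g → 1 ∸ D g)
      S = ∑< (suc m) D
      S≡ : S ≡ n ∸ A
      S≡ = trans (sym (m+n∸n≡m S A)) (cong (_∸ A) increments-total)
      X≡ : X ≡ suc n + A
      X≡ = +-cancelʳ-≡ n X (suc n + A) (begin
        X + n                ≡⟨ cong (_+_ X) (sym increments-total) ⟩
        X + (S + A)          ≡⟨ sym (+-assoc X S A) ⟩
        X + S + A            ≡⟨ cong (_+ A) (∑<-complement (suc m) D (increment≤1 f m)) ⟩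
        suc m + A            ≡⟨ cong (λ z → suc z + A) (dbl≡+ n) ⟩
        suc (n + n) + A      ≡⟨ solve 2 (λ n a → con 1 :+ (n :+ n) :+ a := con 1 :+ n :+ a :+ n) refl n A ⟩
        suc n + A + n        ∎)

count-vanishes : ∀ n j → n < j → count n j ≡ 0
count-vanishes n j n<j = begin
  count n j                                            ≡⟨ length-filter _ (Codes n) ⟩
  sumOver (Codes n) (λ c → χ (nestings n c ≟ j))       ≡⟨ sumOver-cong (Codes n) (λ c c∈ →
                                                            χ-no _ λ e → <⇒≱ n<j (subst (_≤ n) e (Extensions.nestings≤n n c∈))) ⟩
  sumOver (Codes n) (λ _ → 0)                          ≡⟨ sumOver-zero (Codes n) ⟩
  0                                                    ∎
  where open ≡-Reasoning

count-pred : ∀ n j → sumOver (Codes n) (λ c → χ (suc (nestings n c) ≟ j)) ≡ atPred (count n) j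
count-pred n zero    = trans (sumOver-cong (Codes n) (λ c _ → χ-no (suc (nestings n c) ≟ 0) λ ())) (sumOver-zero (Codes n))
count-pred n (suc j) = trans (sumOver-cong (Codes n) (λ c _ → χ-cong _ _ suc-injective (cong suc)))
                             (sym (length-filter _ (Codes n)))

count-step : ∀ n j → count (suc n) j ≡ count n j * (suc n + j) + atPred (count n) j * (suc n ∸ j)
count-step n j = begin
  count (suc n) j
    ≡⟨ length-filter _ (Codes (suc n)) ⟩
  sumOver (Codes (suc n)) (λ c → χ (nestings (suc n) c ≟ j))
    ≡⟨ sumOver-cartesianProductWith (λ c g → g ∷ c) (Codes n) (upTo (suc (dbl n))) _ ⟩
  sumOver (Codes n) (λ c → sumOver (upTo (suc (dbl n))) (λ g → χ (nestings (suc n) (g ∷ c) ≟ j)))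
    ≡⟨ sumOver-cong (Codes n) (λ c c∈ →
         trans (sumOver-applyUpTo (λ g → g) (suc (dbl n)) _) (Extensions.extensions-with n c∈ j)) ⟩
  sumOver (Codes n) (λ c → χ (nestings n c ≟ j) * (suc n + j) + χ (suc (nestings n c) ≟ j) * (suc n ∸ j))
    ≡⟨ sumOver-+ (Codes n) _ _ ⟩
  sumOver (Codes n) (λ c → χ (nestings n c ≟ j) * (suc n + j))
    + sumOver (Codes n) (λ c → χ (suc (nestings n c) ≟ j) * (suc n ∸ j))
    ≡⟨ cong₂ _+_ (sumOver-*ʳ (Codes n) _ (suc n + j)) (sumOver-*ʳ (Codes n) _ (suc n ∸ j)) ⟩
  sumOver (Codes n) (λ c → χ (nestings n c ≟ j)) * (suc n + j)
    + sumOver (Codes n) (λ c → χ (suc (nestings n c) ≟ j)) * (suc n ∸ j)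
    ≡⟨ cong₂ (λ x y → x * (suc n + j) + y * (suc n ∸ j)) (sym (length-filter _ (Codes n))) (count-pred n j) ⟩
  count n j * (suc n + j) + atPred (count n) j * (suc n ∸ j) ∎
  where open ≡-Reasoning

T-step-vanishes : ∀ n k → T (suc n) k ≡ + 0 → T (suc n) (k - + 1) ≡ + 0 → T (suc (suc n)) k ≡ + 0
T-step-vanishes n k T[k] T[k-1] = begin
  k ℤ.* T (suc n) k ℤ.+ (+ (2 * suc (suc n)) - k) ℤ.* T (suc n) (k - + 1)
    ≡⟨ cong₂ (λ x y → k ℤ.* x ℤ.+ (+ (2 * suc (suc n)) - k) ℤ.* y) T[k] T[k-1] ⟩
  k ℤ.* + 0 ℤ.+ (+ (2 * suc (suc n)) - k) ℤ.* + 0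
    ≡⟨ cong₂ ℤ._+_ (ℤ.*-zeroʳ k) (ℤ.*-zeroʳ (+ (2 * suc (suc n)) - k)) ⟩
  + 0 ∎
  where open ≡-Reasoning

T-vanishes : ∀ n i → T n (+ (n + suc i)) ≡ + 0
T-vanishes zero          i = refl
T-vanishes (suc zero)    i = refl
T-vanishes (suc (suc n)) i = T-step-vanishes n (+ (suc (suc n) + suc i))
  (trans (cong (λ z → T (suc n) (+ z)) (sym (+-suc (suc n) (suc i)))) (T-vanishes (suc n) (suc i)))
  (T-vanishes (suc n) i)

⊖-scaled : ∀ a b c → (a < b → c ≡ 0) → (+ a - + b) ℤ.* + c ≡ + (c * (a ∸ b))
⊖-scaled a b c c≡0 with b ≤? a
... | yes b≤a = begin
  (+ a - + b) ℤ.* + c  ≡⟨ cong (ℤ._* + c) (trans (ℤ.[+m]-[+n]≡m⊖n a b) (ℤ.⊖-≥ b≤a)) ⟩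
  + (a ∸ b) ℤ.* + c    ≡⟨ sym (ℤ.pos-* (a ∸ b) c) ⟩
  + ((a ∸ b) * c)      ≡⟨ cong +_ (*-comm (a ∸ b) c) ⟩
  + (c * (a ∸ b))      ∎
  where open ≡-Reasoning
... | no b≰a rewrite c≡0 (≰⇒> b≰a) = ℤ.*-zeroʳ (+ a - + b)

-- Integer identities behind the reindexing k = n - j.
step-down : ∀ a b → (+ 1 ℤ.+ a) - (+ 1 ℤ.+ b) ≡ a - b
step-down = solve-∀

pred-arg : ∀ a b → (+ 1 ℤ.+ a - b) - + 1 ≡ a - b
pred-arg = solve-∀

weight : ∀ a b → a ℤ.+ (a ℤ.+ + 0) - (a - b) ≡ a ℤ.+ b
weight = solve-∀

count-base : ∀ j → T 1 (+ 1 - + j) ≡ + count 1 j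
count-base zero          = refl
count-base (suc zero)    = refl
count-base (suc (suc j)) = refl

count-T : ∀ n j → T (suc n) (+ suc n - + j) ≡ + count (suc n) j
count-T zero    j = count-base j
count-T (suc n) j = begin
  k ℤ.* T (suc n) k ℤ.+ (+ (2 * N) - k) ℤ.* T (suc n) (k - + 1)
    ≡⟨ cong₂ (λ x y → k ℤ.* x ℤ.+ (+ (2 * N) - k) ℤ.* y) (T-atPred j) T[k-1] ⟩
  k ℤ.* + atPred C j ℤ.+ (+ (2 * N) - k) ℤ.* + C j
    ≡⟨ cong₂ ℤ._+_ (⊖-scaled N j (atPred C j) (atPred-vanishes j)) (cong (ℤ._* + C j) (weight (+ N) (+ j))) ⟩
  + (atPred C j * (N ∸ j)) ℤ.+ + (N + j) ℤ.* + C j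
    ≡⟨ cong (ℤ._+_ (+ (atPred C j * (N ∸ j)))) (sym (ℤ.pos-* (N + j) (C j))) ⟩
  + (atPred C j * (N ∸ j) + (N + j) * C j)
    ≡⟨ cong +_ (trans (+-comm (atPred C j * (N ∸ j)) ((N + j) * C j))
                      (cong (_+ atPred C j * (N ∸ j)) (*-comm (N + j) (C j)))) ⟩
  + (C j * (N + j) + atPred C j * (N ∸ j))
    ≡⟨ cong +_ (sym (count-step (suc n) j)) ⟩
  + count N j ∎
  where
    open ≡-Reasoning
    N = suc (suc n)
    C = count (suc n)
    k = + N - + j
    T[k-1] : T (suc n) (k - + 1) ≡ + C j
    T[k-1] = trans (cong (T (suc n)) (pred-arg (+ suc n) (+ j))) (count-T n j)
    T-atPred : ∀ j → T (suc n) (+ N - + j) ≡ + atPred C j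
    T-atPred zero    = trans (cong (λ z → T (suc n) (+ z)) (trans (+-identityʳ N) (sym (+-comm (suc n) 1))))
                             (T-vanishes (suc n) 0)
    T-atPred (suc j) = trans (cong (T (suc n)) (step-down (+ suc n) (+ j))) (count-T n j)
    atPred-vanishes : ∀ j → N < j → atPred C j ≡ 0
    atPred-vanishes (suc j) (s≤s N≤j) = count-vanishes (suc n) j N≤j

clamp : ∀ {m} → Fin m → ℕ → Fin m
clamp {m} i y with y <? m
... | yes y<m = fromℕ< y<m
... | no _    = i

toℕ-clamp : ∀ {m} (i : Fin m) y → y < m → toℕ (clamp i y) ≡ y
toℕ-clamp {m} i y y<m with y <? m
... | yes y<m' = toℕ-fromℕ< y<m'
... | no y≮m   = ⊥-elim (y≮m y<m)

-- A partner map as a vector of positions, and a vector as a partner map (0 off [0, m)).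
toVec : ∀ m → (ℕ → ℕ) → Vec (Fin m) m
toVec m f = tabulate (λ i → clamp i (f (toℕ i)))

ofVec : ∀ {m} → Vec (Fin m) m → ℕ → ℕ
ofVec {m} v x with x <? m
... | yes x<m = toℕ (lookup v (fromℕ< x<m))
... | no _    = 0

ofVec-toℕ : ∀ {m} (v : Vec (Fin m) m) i → ofVec v (toℕ i) ≡ toℕ (lookup v i)
ofVec-toℕ {m} v i with toℕ i <? m
... | yes i<m = cong (toℕ ∘ lookup v) (fromℕ<-toℕ i i<m)
... | no i≮m  = ⊥-elim (i≮m (toℕ<n i))

at-positions : ∀ {m} (P : ℕ → Set) → (∀ (i : Fin m) → P (toℕ i)) → ∀ x → x < m → P x
at-positions P all x x<m = subst P (toℕ-fromℕ< x<m) (all (fromℕ< x<m))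

lookup-toVec : ∀ m f (i : Fin m) → f (toℕ i) < m → toℕ (lookup (toVec m f) i) ≡ f (toℕ i)
lookup-toVec m f i fi<m = trans (cong toℕ (lookup∘tabulate _ i)) (toℕ-clamp i _ fi<m)

ofVec-toVec : ∀ m f → (∀ x → x < m → f x < m) → ∀ x → x < m → ofVec (toVec m f) x ≡ f x
ofVec-toVec m f f< = at-positions (λ x → ofVec (toVec m f) x ≡ f x)
  λ i → trans (ofVec-toℕ (toVec m f) i) (lookup-toVec m f i (f< (toℕ i) (toℕ<n i)))

toVec-ofVec : ∀ m (v : Vec (Fin m) m) → toVec m (ofVec v) ≡ v
toVec-ofVec m v = trans (tabulate-cong λ i → toℕ-injective
    (trans (toℕ-clamp i _ (subst (_< m) (sym (ofVec-toℕ v i)) (toℕ<n _))) (ofVec-toℕ v i)))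
  (tabulate∘lookup v)

toVec-cong : ∀ m {f f'} → (∀ x → x < m → f x ≡ f' x) → toVec m f ≡ toVec m f'
toVec-cong m eq = tabulate-cong λ i → cong (clamp i) (eq (toℕ i) (toℕ<n i))

pairing→matching : ∀ n {f} → IsPairing (2 * n) f → IsMatching {n} (toVec (2 * n) f)
pairing→matching n {f} P i =
  toℕ-injective (trans (lookup-toVec M f _ (subst (λ z → f z < M) (sym e) (proj₁ (P _ (proj₁ Pi)))))
                       (trans (cong f e) (proj₁ (proj₂ Pi)))) ,
  λ eq → proj₂ (proj₂ Pi) (trans (sym e) (cong toℕ eq))
  where
    M = 2 * n
    Pi = P (toℕ i) (toℕ<n i)
    e : toℕ (lookup (toVec M f) i) ≡ f (toℕ i)
    e = lookup-toVec M f i (proj₁ Pi)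

matching→pairing : ∀ n {v : Matching n} → IsMatching {n} v → IsPairing (2 * n) (ofVec v)
matching→pairing n {v} isM = at-positions (λ x → (ofVec v x < 2 * n) × (ofVec v (ofVec v x) ≡ x) × (ofVec v x ≢ x))
  λ i → subst (_< 2 * n) (sym (ofVec-toℕ v i)) (toℕ<n _) ,
        trans (cong (ofVec v) (ofVec-toℕ v i)) (trans (ofVec-toℕ v (lookup v i)) (cong toℕ (proj₁ (isM i)))) ,
        λ e → proj₂ (isM i) (toℕ-injective (trans (sym (ofVec-toℕ v i)) e))

nestAt-cong : ∀ m {F G : ℕ → ℕ} → (∀ x → x < m → F x ≡ G x) → ∀ a → nestAt F m a ≡ nestAt G m a
nestAt-cong m {F} {G} eq a = χ-cong (isNestAt? F m a) (isNestAt? G m a)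
  (λ { (p , x , y , z) → p , subst (a <_) (ea p) x , subst (suc a <_) (eb p) y , subst₂ _<_ (eb p) (ea p) z })
  (λ { (p , x , y , z) → p , subst (a <_) (sym (ea p)) x , subst (suc a <_) (sym (eb p)) y , subst₂ _<_ (sym (eb p)) (sym (ea p)) z })
  where
    ea : suc a < m → F a ≡ G a
    ea p = eq a (<-trans (n<1+n a) p)
    eb : suc a < m → F (suc a) ≡ G (suc a)
    eb p = eq (suc a) p

-- The left-nestings with first point a: the only candidate second point is a + 1.
nestings-from : ∀ {m} (v : Vec (Fin m) m) (a : Fin m) →
  sumOver (allFin m) (λ c → χ (toℕ c ≟ suc (toℕ a) ×-dec (toℕ a <? toℕ (lookup v a) ×-dec
    (toℕ c <? toℕ (lookup v c) ×-dec toℕ (lookup v c) <? toℕ (lookup v a)))))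
  ≡ nestAt (ofVec v) m (toℕ a)
nestings-from {m} v a = begin
  sumOver (allFin m) (λ c → χ (toℕ c ≟ q ×-dec rest c))
    ≡⟨ sumOver-cong (allFin m) (λ c _ → trans (χ-× (toℕ c ≟ q) (rest c)) (cong (χ (toℕ c ≟ q) *_) (rest≡W c))) ⟩
  sumOver (allFin m) (λ c → χ (toℕ c ≟ q) * W (toℕ c))
    ≡⟨ sumOver-cong (allFin m) (λ c _ → χ-≟-* (toℕ c) q W) ⟩
  sumOver (allFin m) (λ c → χ (toℕ c ≟ q) * W q)
    ≡⟨ sumOver-*ʳ (allFin m) (λ c → χ (toℕ c ≟ q)) (W q) ⟩
  sumOver (allFin m) (λ c → χ (toℕ c ≟ q)) * W q
    ≡⟨ cong (_* W q) (trans (sumOver-allFin m (λ i → χ (i ≟ q))) (∑<-δ m q)) ⟩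
  χ (q <? m) * W q
    ≡⟨ sym (χ-× (q <? m) _) ⟩
  nestAt F m (toℕ a) ∎
  where
    open ≡-Reasoning
    F = ofVec v
    q = suc (toℕ a)
    rest : ∀ c → Dec _
    rest c = toℕ a <? toℕ (lookup v a) ×-dec (toℕ c <? toℕ (lookup v c) ×-dec toℕ (lookup v c) <? toℕ (lookup v a))
    W : ℕ → ℕ
    W c' = χ (toℕ a <? F (toℕ a) ×-dec (c' <? F c' ×-dec F c' <? F (toℕ a)))
    rest≡W : ∀ c → χ (rest c) ≡ W (toℕ c)
    rest≡W c rewrite ofVec-toℕ v a | ofVec-toℕ v c = refl

leftNestings-ofVec : ∀ n (v : Matching n) → leftNestings {n} v ≡ ∑< (2 * n) (nestAt (ofVec v) (2 * n))
leftNestings-ofVec n v = begin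
  leftNestings {n} v
    ≡⟨ length-filter (isLeftNesting? {n} v) (cartesianProduct (allFin M) (allFin M)) ⟩
  sumOver (cartesianProduct (allFin M) (allFin M)) (χ ∘ isLeftNesting? {n} v)
    ≡⟨ sumOver-cartesianProductWith _,_ (allFin M) (allFin M) _ ⟩
  sumOver (allFin M) (λ a → sumOver (allFin M) (λ c → χ (isLeftNesting? {n} v (a , c))))
    ≡⟨ sumOver-cong (allFin M) (λ a _ → nestings-from v a) ⟩
  sumOver (allFin M) (λ a → nestAt (ofVec v) M (toℕ a))
    ≡⟨ sumOver-allFin M (nestAt (ofVec v) M) ⟩
  ∑< M (nestAt (ofVec v) M) ∎
  where open ≡-Reasoning
        M = 2 * n

unique-map : ∀ {A B : Set} {f : A → B} xs → Unique xs →
             (∀ {x y} → x ∈ xs → y ∈ xs → f x ≡ f y → x ≡ y) → Unique (map f xs)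
unique-map []       []       inj = []
unique-map (x ∷ xs) (x∉ ∷ u) inj =
  All.map⁺ (All.tabulate λ y∈ e → All.lookup x∉ y∈ (inj (here refl) (there y∈) e))
  ∷ unique-map xs u (λ x∈ y∈ → inj (there x∈) (there y∈))

hasCount-encoding : ∀ {A B : Set} {Q : A → Set} (Q? : Decidable Q) {R : B → Set} (φ : A → B) xs →
  Unique xs → (∀ {x y} → x ∈ xs → y ∈ xs → φ x ≡ φ y → x ≡ y) →
  (∀ {x} → x ∈ xs → R (φ x) ⇔ Q x) → (∀ y → R y → Σ A λ x → x ∈ xs × y ≡ φ x) →
  HasCount R (length (filter Q? xs))
hasCount-encoding Q? {R} φ xs u inj R⇔Q onto =
  map φ (filter Q? xs) ,
  unique-map (filter Q? xs) (Unique.filter⁺ Q? u) (λ x∈ y∈ → inj (proj₁ (∈-filter⁻ Q? x∈)) (proj₁ (∈-filter⁻ Q? y∈))) ,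
  (λ y → mk⇔ (listed⇒R y) (R⇒listed y)) ,
  length-map φ (filter Q? xs)
  where
    listed⇒R : ∀ y → y ∈ map φ (filter Q? xs) → R y
    listed⇒R y y∈ with ∈-map⁻ φ y∈
    ... | x , x∈ , refl with ∈-filter⁻ Q? x∈
    ...   | x∈xs , Qx = Equivalence.from (R⇔Q x∈xs) Qx
    R⇒listed : ∀ y → R y → y ∈ map φ (filter Q? xs)
    R⇒listed y Ry with onto y Ry
    ... | x , x∈ , refl = ∈-map⁺ φ (∈-filter⁺ Q? x∈ (Equivalence.to (R⇔Q x∈) Ry))

2*≡dbl : ∀ n → 2 * n ≡ dbl n
2*≡dbl n = trans (cong (_+_ n) (+-identityʳ n)) (sym (dbl≡+ n))

module Encoding (n : ℕ) where

  M : ℕ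
  M = 2 * n

  encode : List ℕ → Matching n
  encode c = toVec M (decode n c)

  decode-pairing′ : ∀ {c} → c ∈ Codes n → IsPairing M (decode n c)
  decode-pairing′ {c} c∈ = subst (λ z → IsPairing z (decode n c)) (sym (2*≡dbl n)) (decode-pairing n c∈)

  decode-ofVec : ∀ {c} → c ∈ Codes n → ∀ x → x < M → ofVec (encode c) x ≡ decode n c x
  decode-ofVec c∈ = ofVec-toVec M _ (λ x x<M → proj₁ (decode-pairing′ c∈ x x<M))

  encode-matching : ∀ {c} → c ∈ Codes n → IsMatching {n} (encode c)
  encode-matching c∈ = pairing→matching n (decode-pairing′ c∈)

  encode-leftNestings : ∀ {c} → c ∈ Codes n → leftNestings {n} (encode c) ≡ nestings n c
  encode-leftNestings {c} c∈ =
    trans (leftNestings-ofVec n (encode c))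
   (trans (∑<-cong M (λ a _ → nestAt-cong M (decode-ofVec c∈) a))
          (cong (λ z → ∑< z (nestAt (decode n c) z)) (2*≡dbl n)))

  encode-injective : ∀ {c c'} → c ∈ Codes n → c' ∈ Codes n → encode c ≡ encode c' → c ≡ c'
  encode-injective c∈ c'∈ e = decode-injective n c∈ c'∈ λ x x<dbl →
    let x<M = subst (x <_) (sym (2*≡dbl n)) x<dbl in
    trans (sym (decode-ofVec c∈ x x<M)) (trans (cong (λ v → ofVec v x) e) (decode-ofVec c'∈ x x<M))

  encode-surjective : ∀ (v : Matching n) → IsMatching {n} v → Σ (List ℕ) λ c → c ∈ Codes n × v ≡ encode c
  encode-surjective v isM with decode-surjective n (ofVec v) (subst (λ z → IsPairing z (ofVec v)) (2*≡dbl n) (matching→pairing n isM))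
  ... | c , c∈ , agree = c , c∈ ,
    trans (sym (toVec-ofVec M v)) (toVec-cong M λ x x<M → sym (agree x (subst (x <_) (2*≡dbl n) x<M)))

mainTheorem7 : (n : ℕ) → 1 ≤ n → (j : ℕ) →
    Σ ℕ λ N → HasCount (λ (v : Matching n) → IsMatching {n} v × (leftNestings {n} v ≡ j)) N
    × (+ N ≡ T n (+ n - + j))
mainTheorem7 zero    () j
mainTheorem7 (suc n) _  j =
  count (suc n) j ,
  hasCount-encoding (λ c → nestings (suc n) c ≟ j) encode (Codes (suc n)) (Codes-unique (suc n))
    encode-injective
    (λ c∈ → mk⇔ (λ (_ , ln) → trans (sym (encode-leftNestings c∈)) ln)
                (λ ln → encode-matching c∈ , trans (encode-leftNestings c∈) ln))
    (λ v (isM , _) → encode-surjective v isM) ,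
  sym (count-T n j)
  where open Encoding (suc n)
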